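{- In the setting described in the context, suppose $v\in\mathbf{V}_i$ and $w\in\mathbf{V}_j$. Then for every $1\le t\le m$ with $t\ne i$, $\mathrm{fill}_t(\tau)=\mathrm{fill}_t(\tau^{\gamma})$, and in particular $\mu_{\mathbf{X}_t}=\mu'_{\mathbf{X}_t}$. Furthermore, $\mathrm{fill}_i(\tau)\preceq\mathrm{fill}_i(\tau^{\gamma})$ and $\deg(\mu'_{\mathbf{X}_i})\le\deg(\mu_{\mathbf{X}_i})$, where $\mu=\Phi(\tau)$ and $\mu'=\Phi(\tau^{\gamma})$.
   Context: Let $\mathbf{V}=\mathbf{V}_1\cup\cdots\cup\mathbf{V}_m$ (pairwise disjoint finite sets), $\mathbf{a}=(a_1,\ldots,a_m)$ nonnegative integers with $a_i\le|\mathbf{V}_i|$, $1\le d\le\sum_i a_i$. $\Lambda$: simplicial complex on $\mathbf{V}$ with faces the $\tau\subseteq\mathbf{V}$ such that $|\tau\cap\mathbf{V}_i|\le a_i$ for all $i$ and $|\tau|\le d$; facets = faces of size $d$. Order $\mathbf{V}$ by $\succ$ with all of $\mathbf{V}_i$ before $\mathbf{V}_j$ for $i<j$; write $\mathbf{V}_i=\{v^i_1\succ v^i_2\succ\cdots\}$. Revlex on equal-size sets: $S\succ T$ if the $\succ$-least element of the symmetric difference lies in $T$. $\mathcal{R}_{\mathrm{Lex}}(\tau)=\{v\in\tau:\tau-\{v\}\subseteq\tau'\text{ for some facet }\tau'\succ\tau\}$. For a facet $\tau$: $\mathrm{FL}(\tau)=\{i:|\tau\cap\mathbf{V}_i|=a_i\}$;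 $\mathrm{Gap}(\tau)$ is the $\succ$-largest element of $\mathbf{V}$ lying neither in $\tau$ nor in any $\mathbf{V}_i$ with $i\in\mathrm{FL}(\tau)$, if one exists; $\mathrm{tail}(\tau)=\{u\in\tau:u\prec\mathrm{Gap}(\tau)\}$ (empty if no Gap); for $i\in\mathrm{FL}(\tau)$ with $\mathbf{V}_i\not\subseteq\tau$, $\mathrm{fgap}(\tau,i)$ is the $\succ$-largest element of $\mathbf{V}_i-\tau$; $\mathrm{up}(\tau)=\{u\in\tau\cap\mathbf{V}_i:i\in\mathrm{FL}(\tau),\ \mathbf{V}_i\not\subseteq\tau,\ u\prec\mathrm{fgap}(\tau,i)\}$. One has $\mathcal{R}_{\mathrm{Lex}}(\tau)=\mathrm{up}(\tau)\cup\mathrm{tail}(\tau)$. Let $\tau$ be a facet and $\gamma$ a set with $\mathcal{R}_{\mathrm{Lex}}(\tau)\not\subseteq\gamma\subset\tau$; choose $v\in\mathcal{R}_{\mathrm{Lex}}(\tau)-\gamma$. If $v\in\mathrm{tail}(\tau)$ let $w=\mathrm{Gap}(\tau)$; otherwise $v\in\mathrm{up}(\tau)$ and $w=\mathrm{fgap}(\tau,i)$ with $v\in\mathbf{V}_i$. Set $\tau^{\gamma}=(\tau-\{v\})\cup\{w\}$ (a facet of $\Lambda$). $\Phi$: variables $\mathbf{X}_i=\{x^i_1\succ\cdots\succ x^i_{|\mathbf{V}_i|-a_i}\}$ ($1\le i\le m$), $\mathbf{X}_0=\{x^0_1\succ\cdots\succ x^0_c\}$, $c=(\sum a_i)-d$;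 $\mu_Y$ = part of $\mu$ supported in $Y$. For totally ordered $V=\{v_1\succ\cdots\succ v_N\}$, $0\le a\le N$, $X=\{x_1\succ\cdots\succ x_{N-a}\}$, $\phi(V,X)$ sends an $a$-subset $\{v_1,\ldots,v_t,v_{i_1},\ldots,v_{i_s}\}$ ($t+s=a$, $t+1<i_1<\cdots<i_s$) to $x_{i_1-(t+1)}\cdots x_{i_s-(t+s)}$. For a facet $\tau$, $\mathrm{fill}_i(\tau)$ = revlex-first $a_i$-subset of $\mathbf{V}_i$ containing $\tau\cap\mathbf{V}_i$; $\Phi_i(\tau)=\phi(\mathbf{V}_i,\mathbf{X}_i)(\mathrm{fill}_i(\tau))$; $\mathbf{V}[\tau]$ = the $\succ$-first $a_i-\deg\Phi_i(\tau)$ elements of each $\mathbf{V}_i$; $\Phi_0(\tau)=\phi(\mathbf{V}[\tau],\mathbf{X}_0)(\tau\cap\mathbf{V}[\tau])$; $\Phi(\tau)=\prod_{i=0}^m\Phi_i(\tau)$ (so $\Phi(\tau)_{\mathbf{X}_i}=\Phi_i(\tau)$). -}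

module Defs where

open import Data.Nat using (ℕ; zero; suc; _+_; _∸_; _≤_; _<_; _≡ᵇ_; _≤ᵇ_)
open import Data.Bool using (Bool; true; false; _∧_; _∨_; not; if_then_else_)
open import Data.Fin using (Fin; toℕ)
open import Data.Fin.Subset using (Subset; _∈_; _∉_; _⊆_; ∣_∣)
open import Data.Vec using (Vec; []; _∷_; tabulate; lookup; sum)
open import Data.List using (List; []; _∷_)
open import Data.Product using (Σ; _×_; _,_)
open import Data.Sum using (_⊎_)
open import Relation.Binary.PropositionalEquality using (_≡_)
open import Relation.Nullary using (¬_)

total : {m : ℕ} → (Fin m → ℕ) → ℕ
total f = sum (tabulate f)

-- Vertices.  V = V_1 ∪ ... ∪ V_m with |V_i| = n i.  The vertex v^i_{k+1}
-- is represented by (i , k) with k : Fin (n i) (k = 0 is v^i_1).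

Vertex : {m : ℕ} → (Fin m → ℕ) → Set
Vertex {m} n = Σ (Fin m) (λ i → Fin (n i))

-- Before n u w  :  u ≻ w  (u comes strictly earlier in the total order ≻).
Before : {m : ℕ} (n : Fin m → ℕ) → Vertex n → Vertex n → Set
Before n (i , k) (j , l) = (toℕ i < toℕ j) ⊎ ((toℕ i ≡ toℕ j) × (toℕ k < toℕ l))

VSet : {m : ℕ} → (Fin m → ℕ) → Set
VSet {m} n = (i : Fin m) → Subset (n i)

_∈V_ : {m : ℕ} {n : Fin m → ℕ} → Vertex n → VSet n → Set
(i , k) ∈V S = k ∈ S i

_∉V_ : {m : ℕ} {n : Fin m → ℕ} → Vertex n → VSet n → Set
u ∉V S = ¬ (u ∈V S)

Facet : {m : ℕ} (n a : Fin m → ℕ) (d : ℕ) → VSet n → Set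
Facet n a d τ = (∀ i → ∣ τ i ∣ ≤ a i) × (total (λ i → ∣ τ i ∣) ≡ d)

-- Revlex on subsets of V:  RevGtV S T  means  S ≻ T, i.e. the ≻-least
-- element of the symmetric difference lies in T.
RevGtV : {m : ℕ} (n : Fin m → ℕ) → VSet n → VSet n → Set
RevGtV n S T = Σ (Vertex n) λ p → (p ∉V S) × (p ∈V T) ×
  (∀ q → Before n p q → ((q ∈V S → q ∈V T) × (q ∈V T → q ∈V S)))

InRLex : {m : ℕ} (n a : Fin m → ℕ) (d : ℕ) → VSet n → Vertex n → Set
InRLex n a d τ v = (v ∈V τ) × Σ (VSet n) λ τ' → Facet n a d τ' × RevGtV n τ' τ ×
  (∀ u → u ∈V τ → ¬ (u ≡ v) → u ∈V τ')

FL : {m : ℕ} (n a : Fin m → ℕ) → VSet n → Fin m → Set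
FL n a τ i = ∣ τ i ∣ ≡ a i

IsGap : {m : ℕ} (n a : Fin m → ℕ) → VSet n → Vertex n → Set
IsGap n a τ (j , l) = (l ∉ τ j) × ¬ FL n a τ j ×
  (∀ u → u ∉V τ → ¬ FL n a τ (Data.Product.proj₁ u) → ¬ Before n u (j , l))

InTail : {m : ℕ} (n a : Fin m → ℕ) → VSet n → Vertex n → Set
InTail n a τ u = (u ∈V τ) × Σ (Vertex n) λ g → IsGap n a τ g × Before n g u

IsFgap : {m : ℕ} (n a : Fin m → ℕ) → VSet n → (i : Fin m) → Fin (n i) → Set
IsFgap n a τ i f = FL n a τ i × (f ∉ τ i) × (∀ l → l ∉ τ i → toℕ f ≤ toℕ l)

InUp : {m : ℕ} (n a : Fin m → ℕ) → VSet n → Vertex n → Set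
InUp n a τ (i , k) = (k ∈ τ i) × Σ (Fin (n i)) λ f → IsFgap n a τ i f × (toℕ f < toℕ k)

WChoice : {m : ℕ} (n a : Fin m → ℕ) → VSet n → Vertex n → Vertex n → Set
WChoice n a τ v w =
    (InTail n a τ v × IsGap n a τ w)
  ⊎ (¬ InTail n a τ v × InUp n a τ v ×
     Σ (Fin (n (Data.Product.proj₁ v))) λ f →
       IsFgap n a τ (Data.Product.proj₁ v) f × (w ≡ (Data.Product.proj₁ v , f)))

-- τ^γ = (τ - {v}) ∪ {w}.
isVtx : {m : ℕ} {n : Fin m → ℕ} → Vertex n → (t : Fin m) → Fin (n t) → Bool
isVtx (i , k) t l = (toℕ i ≡ᵇ toℕ t) ∧ (toℕ k ≡ᵇ toℕ l)

exchange : {m : ℕ} {n : Fin m → ℕ} → VSet n → Vertex n → Vertex n → VSet n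
exchange τ v w t = tabulate λ l → (not (isVtx v t l) ∧ lookup (τ t) l) ∨ isVtx w t l

ProperSubV : {m : ℕ} (n : Fin m → ℕ) → VSet n → VSet n → Set
ProperSubV n γ τ = (∀ u → u ∈V γ → u ∈V τ) × Σ (Vertex n) λ u → (u ∈V τ) × (u ∉V γ)

-- Revlex on subsets of a single block V_t (positions Fin N, 0 = ≻-first).
-- RevGt S T : S ≻ T.
RevGt : {N : ℕ} → Subset N → Subset N → Set
RevGt {N} S T = Σ (Fin N) λ p → (p ∉ S) × (p ∈ T) ×
  (∀ q → toℕ p < toℕ q → ((q ∈ S → q ∈ T) × (q ∈ T → q ∈ S)))

RevLe : {N : ℕ} → Subset N → Subset N → Set
RevLe S T = (S ≡ T) ⊎ RevGt T S

IsFill : {m : ℕ} (n a : Fin m → ℕ) → VSet n → (t : Fin m) → Subset (n t) → Set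
IsFill n a τ t F = (∣ F ∣ ≡ a t) × (τ t ⊆ F) ×
  (∀ G → ∣ G ∣ ≡ a t → τ t ⊆ G → RevLe G F)

-- φ(V,X): an a-subset {v_1..v_t, v_{i_1},...,v_{i_s}} (t maximal) is sent to
-- x_{i_1-(t+1)} ⋯ x_{i_s-(t+s)}; a monomial is represented by the list of the
-- indices of its variable factors (with multiplicity), so its degree is its length.

leadRun : {N : ℕ} → Subset N → ℕ
leadRun [] = 0
leadRun (true ∷ xs) = suc (leadRun xs)
leadRun (false ∷ xs) = 0

-- phiGo t pos k xs : pos = 1-based position of the head of xs,
-- k = number of i_j's already emitted.
phiGo : {N : ℕ} → ℕ → ℕ → ℕ → Subset N → List ℕ
phiGo t pos k [] = []
phiGo t pos k (true ∷ xs) =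
  if pos ≤ᵇ t then phiGo t (suc pos) k xs
  else (pos ∸ (t + suc k)) ∷ phiGo t (suc pos) (suc k) xs
phiGo t pos k (false ∷ xs) = phiGo t (suc pos) k xs

phi : {N : ℕ} → Subset N → List ℕ
phi S = phiGo (leadRun S) 1 0 S

module Submission where

-- The key fact about fills is that the
-- elements of fill(S) − S precede every element outside fill(S): otherwise
-- swapping them would give a revlex-earlier a-subset containing S.  If v lies
-- in tail(τ), then w = Gap(τ) is the first vertex missing from τ in a non-full
-- block, so w ∈ fill(τ) and τ^γ ∩ V_t ⊆ fill_t(τ) for every t; this forces
-- equal fills off V_i and, on V_i, a revlex-later fill whose leading run
-- v_1 ≻ v_2 ≻ ⋯ is no shorter.  If v lies in up(τ), V_i is full, both fills
-- on V_i are the blocks themselves, and v is replaced by the earlier fgap(τ,i).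
-- Finally deg φ(F) = |F| − (length of the leading run of F).

open import Defs
open import Data.Nat using (ℕ; zero; suc; _+_; _≤_; _<_; _≤ᵇ_; z≤n; s≤s)
open import Data.Nat.Properties
  using (module ≤-Reasoning; <-cmp; <-irrefl; <-asym; <⇒≱; ≮⇒≥; ≤∧≢⇒<; ≤-antisym; ≤-refl;
         ≤-<-trans; <-≤-trans; m≤n⇒m≤1+n; +-identityʳ; +-suc; +-monoʳ-≤; +-cancelʳ-≤;
         suc-injective; m≤m+n; ≤ᵇ⇒≤; ≤⇒≤ᵇ; ≡ᵇ⇒≡; ≡⇒≡ᵇ)
open import Data.Bool using (Bool; true; false; _∧_; _∨_; not; T)
open import Data.Bool.Properties using (T-∧; T-≡)
open import Data.Fin using (Fin; zero; suc; toℕ)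
open import Data.Fin.Properties using (toℕ-injective)
open import Data.Fin.Subset using (Subset; _∈_; _∉_; _⊆_; ∣_∣; _-_; _∪_; ⁅_⁆; inside; outside)
open import Data.Fin.Subset.Properties
  using (_∈?_; drop-there; ⊆-antisym; p⊆q⇒∣p∣≤∣q∣; p⊂q⇒∣p∣<∣q∣; p─⊥≡p; ∪-identityʳ;
         x∈p∪q⁻; x∈p∪q⁺; x∈⁅x⁆; x∈⁅y⁆⇒x≡y; x∈p∧x≢y⇒x∈p-y; p─q⊆p)
open import Data.List using (length)
open import Data.Vec using ([]; _∷_; tabulate; lookup; here; there)
open import Data.Vec.Properties using (lookup∘tabulate; []=⇒lookup; lookup⇒[]=)
open import Data.Product using (_×_; _,_; proj₁; proj₂)
open import Data.Sum using (_⊎_; inj₁; inj₂)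
open import Data.Empty using (⊥-elim)
open import Function using (_∘_; _∋_; Equivalence)
open import Relation.Binary using (tri<; tri≈; tri>)
open import Relation.Binary.PropositionalEquality using (_≡_; _≢_; refl; sym; trans; cong; subst)
open import Relation.Nullary using (¬_; yes; no)

private variable
  N : ℕ
  p S S' F F' : Subset N
  x y z : Fin N

replace : Subset N → Fin N → Fin N → Subset N
replace p x y = (p - x) ∪ ⁅ y ⁆

x∉p-x : (p : Subset N) (x : Fin N) → x ∉ p - x
x∉p-x (_ ∷ p) zero ()
x∉p-x (_ ∷ p) (suc x) x∈ = x∉p-x p x (drop-there x∈)

∈-replace⁻ : z ∈ replace p x y → (z ∈ p × z ≢ x) ⊎ z ≡ y
∈-replace⁻ {p = p} {x} {y} z∈ with x∈p∪q⁻ (p - x) ⁅ y ⁆ z∈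
... | inj₁ z∈p-x = inj₁ (p─q⊆p p ⁅ x ⁆ z∈p-x , λ { refl → x∉p-x p x z∈p-x })
... | inj₂ z∈⁅y⁆ = inj₂ (x∈⁅y⁆⇒x≡y y z∈⁅y⁆)

∈-replace⁺ˡ : z ∈ p → z ≢ x → z ∈ replace p x y
∈-replace⁺ˡ z∈p z≢x = x∈p∪q⁺ (inj₁ (x∈p∧x≢y⇒x∈p-y z∈p z≢x))

∈-replace⁺ʳ : y ∈ replace p x y
∈-replace⁺ʳ {y = y} = x∈p∪q⁺ (inj₂ (x∈⁅x⁆ y))

suc∣p-x∣≡∣p∣ : x ∈ p → suc ∣ p - x ∣ ≡ ∣ p ∣
suc∣p-x∣≡∣p∣ {p = inside ∷ p} here = cong (suc ∘ ∣_∣) (p─⊥≡p p)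
suc∣p-x∣≡∣p∣ {p = inside ∷ p} (there x∈p) = cong suc (suc∣p-x∣≡∣p∣ x∈p)
suc∣p-x∣≡∣p∣ {p = outside ∷ p} (there x∈p) = suc∣p-x∣≡∣p∣ x∈p

∣p∪⁅x⁆∣≡suc∣p∣ : x ∉ p → ∣ p ∪ ⁅ x ⁆ ∣ ≡ suc ∣ p ∣
∣p∪⁅x⁆∣≡suc∣p∣ {x = zero} {p = inside ∷ p} x∉p = ⊥-elim (x∉p here)
∣p∪⁅x⁆∣≡suc∣p∣ {x = zero} {p = outside ∷ p} x∉p = cong (suc ∘ ∣_∣) (∪-identityʳ p)
∣p∪⁅x⁆∣≡suc∣p∣ {x = suc x} {p = inside ∷ p} x∉p = cong suc (∣p∪⁅x⁆∣≡suc∣p∣ (x∉p ∘ there))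
∣p∪⁅x⁆∣≡suc∣p∣ {x = suc x} {p = outside ∷ p} x∉p = ∣p∪⁅x⁆∣≡suc∣p∣ (x∉p ∘ there)

∣replace∣ : x ∈ p → y ∉ p → ∣ replace p x y ∣ ≡ ∣ p ∣
∣replace∣ {x = x} {p = p} {y = y} x∈p y∉p =
  trans (∣p∪⁅x⁆∣≡suc∣p∣ {x = y} (y∉p ∘ p─q⊆p p ⁅ x ⁆)) (suc∣p-x∣≡∣p∣ x∈p)

RevGt-asym : RevGt S F → ¬ RevGt F S
RevGt-asym {S = S} (x , x∉S , x∈F , above-x) (y , y∉F , y∈S , above-y)
  with <-cmp (toℕ x) (toℕ y)
... | tri< x<y _ _ = y∉F (proj₁ (above-x y x<y) y∈S)
... | tri≈ _ x≡y _ = x∉S (subst (_∈ S) (sym (toℕ-injective x≡y)) y∈S)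
... | tri> _ _ y<x = x∉S (proj₁ (above-y x y<x) x∈F)

RevLe⇒¬RevGt : RevLe S F → ¬ RevGt S F
RevLe⇒¬RevGt (inj₁ refl) S≻S = RevGt-asym S≻S S≻S
RevLe⇒¬RevGt (inj₂ F≻S) S≻F = RevGt-asym F≻S S≻F

RevLe-antisym : RevLe S F → RevLe F S → S ≡ F
RevLe-antisym (inj₁ S≡F) _ = S≡F
RevLe-antisym (inj₂ F≻S) F⪯S = ⊥-elim (RevLe⇒¬RevGt F⪯S F≻S)

replace-by-earlier-RevGt : x ∈ p → toℕ y < toℕ x → RevGt (replace p x y) p
replace-by-earlier-RevGt {x = x} {p = p} {y = y} x∈p y<x =
  x , x∉replace , x∈p , λ q x<q → replace⊆p x<q , λ q∈p → ∈-replace⁺ˡ q∈p (q≢x x<q)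
  where
  q≢x : ∀ {q} → toℕ x < toℕ q → q ≢ x
  q≢x x<q refl = <-irrefl refl x<q

  x∉replace : x ∉ replace p x y
  x∉replace x∈ with ∈-replace⁻ x∈
  ... | inj₁ (_ , x≢x) = x≢x refl
  ... | inj₂ refl = <-irrefl refl y<x

  replace⊆p : ∀ {q} → toℕ x < toℕ q → q ∈ replace p x y → q ∈ p
  replace⊆p x<q q∈ with ∈-replace⁻ q∈
  ... | inj₁ (q∈p , _) = q∈p
  ... | inj₂ refl = ⊥-elim (<-asym y<x x<q)

-- IsFill n a τ t F unfolds to IsFillOf (a t) (τ t) F.
IsFillOf : ℕ → Subset N → Subset N → Set
IsFillOf a S F = (∣ F ∣ ≡ a) × (S ⊆ F) × (∀ G → ∣ G ∣ ≡ a → S ⊆ G → RevLe G F)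

module _ {a : ℕ} where

  -- Otherwise swapping x for y would give a revlex-earlier a-subset containing S.
  fill-padding-precedes : IsFillOf a S F → x ∈ F → x ∉ S → y ∉ F → toℕ x ≤ toℕ y
  fill-padding-precedes {S = S} {F = F} {x = x} {y = y} (∣F∣≡a , S⊆F , revlex-first) x∈F x∉S y∉F =
    ≮⇒≥ λ y<x → RevLe⇒¬RevGt (revlex-first G ∣G∣≡a S⊆G) (replace-by-earlier-RevGt x∈F y<x)
    where
    G = replace F x y
    ∣G∣≡a : ∣ G ∣ ≡ a
    ∣G∣≡a = trans (∣replace∣ x∈F y∉F) ∣F∣≡a
    S⊆G : S ⊆ G
    S⊆G z∈S = ∈-replace⁺ˡ (S⊆F z∈S) λ { refl → x∉S z∈S }

  fill-unique : IsFillOf a S F → IsFillOf a S' F' → S ⊆ S' → S' ⊆ F → F ≡ F'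
  fill-unique (∣F∣≡a , _ , F-first) (∣F'∣≡a , S'⊆F' , F'-first) S⊆S' S'⊆F =
    RevLe-antisym (F'-first _ ∣F∣≡a S'⊆F) (F-first _ ∣F'∣≡a (S'⊆F' ∘ S⊆S'))

  fill-full : IsFillOf a S F → ∣ S ∣ ≡ a → F ≡ S
  fill-full {S = S} {F = F} (∣F∣≡a , S⊆F , _) ∣S∣≡a = ⊆-antisym F⊆S S⊆F
    where
    F⊆S : F ⊆ S
    F⊆S {z} z∈F with z ∈? S
    ... | yes z∈S = z∈S
    ... | no z∉S = ⊥-elim (<-irrefl (trans ∣S∣≡a (sym ∣F∣≡a)) (p⊂q⇒∣p∣<∣q∣ (S⊆F , z , z∈F , z∉S)))

  fill-∋-first-free : IsFillOf a S F → ∣ S ∣ < a → y ∉ S → (∀ z → z ∉ S → toℕ y ≤ toℕ z) → y ∈ F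
  fill-∋-first-free {S = S} {F = F} {y = y} fill@(∣F∣≡a , _ , _) ∣S∣<a y∉S y-first with y ∈? F
  ... | yes y∈F = y∈F
  ... | no y∉F = ⊥-elim (<⇒≱ ∣S∣<a (subst (_≤ ∣ S ∣) ∣F∣≡a (p⊆q⇒∣p∣≤∣q∣ F⊆S)))
    where
    F⊆S : F ⊆ S
    F⊆S {z} z∈F with z ∈? S
    ... | yes z∈S = z∈S
    ... | no z∉S = ⊥-elim (y∉F (subst (_∈ F) z≡y z∈F))
      where
      z≡y : z ≡ y
      z≡y = toℕ-injective (≤-antisym (fill-padding-precedes fill z∈F z∉S y∉F) (y-first z z∉S))

leadRun-mem : (p : Subset N) (q : Fin N) → toℕ q < leadRun p → q ∈ p
leadRun-mem (inside ∷ p) zero _ = here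
leadRun-mem (inside ∷ p) (suc q) (s≤s q<run) = there (leadRun-mem p q q<run)

leadRun-mono : (p p' : Subset N) → (∀ q → toℕ q < leadRun p → q ∈ p') → leadRun p ≤ leadRun p'
leadRun-mono [] _ _ = z≤n
leadRun-mono (outside ∷ p) _ _ = z≤n
leadRun-mono (inside ∷ p) (inside ∷ p') run⊆p' =
  s≤s (leadRun-mono p p' λ q q<run → drop-there (run⊆p' (suc q) (s≤s q<run)))
leadRun-mono (inside ∷ p) (outside ∷ p') run⊆p' with run⊆p' zero (s≤s z≤n)
... | ()

leadRun≤free : (p : Subset N) → y ∉ p → leadRun p ≤ toℕ y
leadRun≤free {y = y} p y∉p = ≮⇒≥ (y∉p ∘ leadRun-mem p y)

leadRun-fill-maximal : ∀ {a} {G} → IsFillOf a S' F' → S' ⊆ G → ∣ G ∣ ≡ a → leadRun G ≤ leadRun F'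
leadRun-fill-maximal {F' = F'} {G = G} fill@(∣F'∣≡a , _ , _) S'⊆G ∣G∣≡a =
  leadRun-mono G F' run⊆F'
  where
  run⊆F' : ∀ q → toℕ q < leadRun G → q ∈ F'
  run⊆F' q q<run with q ∈? F'
  ... | yes q∈F' = q∈F'
  ... | no q∉F' = ⊥-elim (<-irrefl (trans ∣F'∣≡a (sym ∣G∣≡a))
                                   (p⊂q⇒∣p∣<∣q∣ (F'⊆G , q , leadRun-mem G q q<run , q∉F')))
    where
    F'⊆G : F' ⊆ G
    F'⊆G {y} y∈F' with y ∈? G
    ... | yes y∈G = y∈G
    ... | no y∉G = ⊥-elim (y∉G (leadRun-mem G y
            (≤-<-trans (fill-padding-precedes fill y∈F' (y∉G ∘ S'⊆G) q∉F') q<run)))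

replace-by-earlier-leadRun : x ∈ p → y ∉ p → toℕ y < toℕ x → leadRun p ≤ leadRun (replace p x y)
replace-by-earlier-leadRun {p = p} x∈p y∉p y<x = leadRun-mono p _ λ q q<run →
  ∈-replace⁺ˡ (leadRun-mem p q q<run) λ { refl → <-asym y<x (<-≤-trans q<run (leadRun≤free p y∉p)) }

length-phiGo-beyond : ∀ t pos k (p : Subset N) → t < pos → length (phiGo t pos k p) ≡ ∣ p ∣
length-phiGo-beyond t pos k [] _ = refl
length-phiGo-beyond t pos k (outside ∷ p) t<pos = length-phiGo-beyond t (suc pos) k p (m≤n⇒m≤1+n t<pos)
length-phiGo-beyond t pos k (inside ∷ p) t<pos with pos ≤ᵇ t in pos≤ᵇt
... | true = ⊥-elim (<⇒≱ t<pos (≤ᵇ⇒≤ pos t (subst T (sym pos≤ᵇt) _)))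
... | false = cong suc (length-phiGo-beyond t (suc pos) (suc k) p (m≤n⇒m≤1+n t<pos))

length-phiGo : ∀ r t pos k (p : Subset N) → pos + r ≡ suc t → r ≤ leadRun p →
  length (phiGo t pos k p) + r ≡ ∣ p ∣
length-phiGo zero t pos k p pos+0≡1+t _ =
  trans (+-identityʳ _)
    (length-phiGo-beyond t pos k p (subst (suc t ≤_) (trans (sym pos+0≡1+t) (+-identityʳ pos)) ≤-refl))
length-phiGo (suc r) t pos k (inside ∷ p) pos+r≡1+t (s≤s r≤run) with pos ≤ᵇ t in pos≤ᵇt
... | true =
  trans (+-suc _ r) (cong suc (length-phiGo r t (suc pos) k p (trans (sym (+-suc pos r)) pos+r≡1+t) r≤run))
... | false = ⊥-elim (subst T pos≤ᵇt (≤⇒≤ᵇ pos≤t))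
  where
  pos≤t : pos ≤ t
  pos≤t = subst (pos ≤_) (suc-injective (trans (sym (+-suc pos r)) pos+r≡1+t)) (m≤m+n pos r)

length-phi : (p : Subset N) → length (phi p) + leadRun p ≡ ∣ p ∣
length-phi p = length-phiGo (leadRun p) (leadRun p) 1 0 p refl ≤-refl

length-phi-antitone : ∣ F ∣ ≡ ∣ F' ∣ → leadRun F ≤ leadRun F' → length (phi F') ≤ length (phi F)
length-phi-antitone {F = F} {F' = F'} ∣F∣≡∣F'∣ run≤run' = +-cancelʳ-≤ (leadRun F') _ _ (begin
  length (phi F') + leadRun F'  ≡⟨ length-phi F' ⟩
  ∣ F' ∣                       ≡⟨ sym ∣F∣≡∣F'∣ ⟩
  ∣ F ∣                        ≡⟨ sym (length-phi F) ⟩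
  length (phi F) + leadRun F    ≤⟨ +-monoʳ-≤ (length (phi F)) run≤run' ⟩
  length (phi F) + leadRun F'   ∎)
  where open ≤-Reasoning

∈-tabulate⁻ : {f : Fin N → Bool} → z ∈ tabulate f → T (f z)
∈-tabulate⁻ {z = z} {f} z∈ = Equivalence.from T-≡ (trans (sym (lookup∘tabulate f z)) ([]=⇒lookup z∈))

∈-tabulate⁺ : {f : Fin N → Bool} → T (f z) → z ∈ tabulate f
∈-tabulate⁺ {z = z} {f} fz = lookup⇒[]= z _ (trans (lookup∘tabulate f z) (Equivalence.to T-≡ fz))

T-lookup⁻ : T (lookup p z) → z ∈ p
T-lookup⁻ {p = p} {z} h = lookup⇒[]= z p (Equivalence.to T-≡ h)

T-lookup⁺ : z ∈ p → T (lookup p z)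
T-lookup⁺ z∈p = Equivalence.from T-≡ ([]=⇒lookup z∈p)

T-remove-add⁻ : ∀ b l c → T ((not b ∧ l) ∨ c) → (¬ T b × T l) ⊎ T c
T-remove-add⁻ _ _ true _ = inj₂ _
T-remove-add⁻ false true false _ = inj₁ ((λ ()) , _)

T-remove-add⁺ˡ : ∀ b l c → ¬ T b → T l → T ((not b ∧ l) ∨ c)
T-remove-add⁺ˡ true _ _ ¬b _ = ⊥-elim (¬b _)
T-remove-add⁺ˡ false true _ _ _ = _

T-remove-add⁺ʳ : ∀ b l c → T c → T ((not b ∧ l) ∨ c)
T-remove-add⁺ʳ true _ true _ = _
T-remove-add⁺ʳ false true true _ = _
T-remove-add⁺ʳ false false true _ = _

module _ {m : ℕ} {n : Fin m → ℕ} {τ : VSet n} where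

  isVtx⇒≡ : (v : Vertex n) (t : Fin m) (z : Fin (n t)) → T (isVtx v t z) → v ≡ (t , z)
  isVtx⇒≡ (i , k) t z h with Equivalence.to T-∧ h
  ... | i≡ᵇt , k≡ᵇz with toℕ-injective {i = i} {t} (≡ᵇ⇒≡ _ _ i≡ᵇt)
  ... | refl with toℕ-injective {i = k} {z} (≡ᵇ⇒≡ _ _ k≡ᵇz)
  ... | refl = refl

  isVtx-refl : (t : Fin m) (z : Fin (n t)) → T (isVtx {n = n} (t , z) t z)
  isVtx-refl t z = Equivalence.from T-∧ (≡⇒≡ᵇ (toℕ t) _ refl , ≡⇒≡ᵇ (toℕ z) _ refl)

  ∈-exchange⁻ : ∀ {v w t} {z : Fin (n t)} → z ∈ exchange τ v w t → (z ∈ τ t × v ≢ (t , z)) ⊎ w ≡ (t , z)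
  ∈-exchange⁻ {v} {w} {t} {z} z∈
    with T-remove-add⁻ (isVtx v t z) (lookup (τ t) z) (isVtx w t z) (∈-tabulate⁻ z∈)
  ... | inj₁ (v≢tz , z∈τ) = inj₁ (T-lookup⁻ z∈τ , λ { refl → v≢tz (isVtx-refl t z) })
  ... | inj₂ w≡tz = inj₂ (isVtx⇒≡ w t z w≡tz)

  ∈-exchange⁺ˡ : ∀ {v w t} {z : Fin (n t)} → z ∈ τ t → v ≢ (t , z) → z ∈ exchange τ v w t
  ∈-exchange⁺ˡ {v} {w} {t} {z} z∈τ v≢tz = ∈-tabulate⁺
    (T-remove-add⁺ˡ (isVtx v t z) (lookup (τ t) z) (isVtx w t z) (v≢tz ∘ isVtx⇒≡ v t z) (T-lookup⁺ z∈τ))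

  ∈-exchange⁺ʳ : ∀ {v t} {z : Fin (n t)} → z ∈ exchange τ v (t , z) t
  ∈-exchange⁺ʳ {v} {t} {z} = ∈-tabulate⁺ (T-remove-add⁺ʳ (isVtx v t z) (lookup (τ t) z) _ (isVtx-refl t z))

  τ⊆exchange : ∀ {v w t} → t ≢ proj₁ v → τ t ⊆ exchange τ v w t
  τ⊆exchange {v} {w} t≢i z∈τ = ∈-exchange⁺ˡ {v} {w} z∈τ (t≢i ∘ sym ∘ cong proj₁)

  exchange⊆τ : ∀ {v w t} → t ≢ proj₁ w → exchange τ v w t ⊆ τ t
  exchange⊆τ {v} {w} t≢j z∈ with ∈-exchange⁻ {v} {w} z∈
  ... | inj₁ (z∈τ , _) = z∈τ
  ... | inj₂ w≡tz = ⊥-elim (t≢j (sym (cong proj₁ w≡tz)))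

  exchange-within-block : ∀ {i} {k f : Fin (n i)} → exchange τ (i , k) (i , f) i ≡ replace (τ i) k f
  exchange-within-block {i} {k} {f} = ⊆-antisym exchange⊆replace replace⊆exchange
    where
    second-≡ : ∀ {x y : Fin (n i)} → (Vertex n ∋ (i , x)) ≡ (i , y) → x ≡ y
    second-≡ eq = toℕ-injective (cong (λ u → toℕ (proj₂ u)) eq)

    exchange⊆replace : exchange τ (i , k) (i , f) i ⊆ replace (τ i) k f
    exchange⊆replace z∈ with ∈-exchange⁻ {i , k} {i , f} z∈
    ... | inj₁ (z∈τ , ik≢iz) = ∈-replace⁺ˡ z∈τ (ik≢iz ∘ cong (i ,_) ∘ sym)
    ... | inj₂ if≡iz = subst (_∈ replace (τ i) k f) (second-≡ if≡iz) ∈-replace⁺ʳ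

    replace⊆exchange : replace (τ i) k f ⊆ exchange τ (i , k) (i , f) i
    replace⊆exchange z∈ with ∈-replace⁻ z∈
    ... | inj₁ (z∈τ , z≢k) = ∈-exchange⁺ˡ {i , k} {i , f} z∈τ (z≢k ∘ sym ∘ second-≡)
    ... | inj₂ refl = ∈-exchange⁺ʳ {i , k}

fill-dominates : ∀ {a G} → ∣ G ∣ ≡ a → S' ⊆ G → IsFillOf a S' F' → RevLe G F' × leadRun G ≤ leadRun F'
fill-dominates ∣G∣≡a S'⊆G fill@(_ , _ , revlex-first) =
  revlex-first _ ∣G∣≡a S'⊆G , leadRun-fill-maximal fill S'⊆G ∣G∣≡a

fill-replace-by-earlier : ∀ {a} {k f : Fin N} → k ∈ S → f ∉ S → toℕ f < toℕ k → ∣ S ∣ ≡ a →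
  IsFillOf a S F → IsFillOf a (replace S k f) F' → RevLe F F' × leadRun F ≤ leadRun F'
fill-replace-by-earlier k∈S f∉S f<k ∣S∣≡a fill fill'
  rewrite fill-full fill ∣S∣≡a | fill-full fill' (trans (∣replace∣ k∈S f∉S) ∣S∣≡a) =
  inj₂ (replace-by-earlier-RevGt k∈S f<k) , replace-by-earlier-leadRun k∈S f∉S f<k

module _ {m : ℕ} {n a : Fin m → ℕ} {τ : VSet n} (τ-small : ∀ t → ∣ τ t ∣ ≤ a t) where

  gap-∈-fill : ∀ {j l} {F : Subset (n j)} → IsGap n a τ (j , l) → IsFill n a τ j F → l ∈ F
  gap-∈-fill {j} (l∉τ , ¬full , gap-first) fill =
    fill-∋-first-free fill (≤∧≢⇒< (τ-small j) ¬full) l∉τ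
      λ z z∉τ → ≮⇒≥ λ z<l → gap-first (j , z) z∉τ ¬full (inj₂ (refl , z<l))

  exchange-gap⊆fill : ∀ {v w t} {F : Subset (n t)} → IsGap n a τ w → IsFill n a τ t F → exchange τ v w t ⊆ F
  exchange-gap⊆fill {v} {w} gap fill@(_ , τ⊆F , _) z∈ with ∈-exchange⁻ {τ = τ} {v} {w} z∈
  ... | inj₁ (z∈τ , _) = τ⊆F z∈τ
  ... | inj₂ refl = gap-∈-fill gap fill

  exchange⊆fill-off-block : ∀ {i k w t} {F : Subset (n t)} → WChoice n a τ (i , k) w → t ≢ i →
    IsFill n a τ t F → exchange τ (i , k) w t ⊆ F
  exchange⊆fill-off-block {i} {k} (inj₁ (_ , gap)) _ fill = exchange-gap⊆fill {v = i , k} gap fill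
  exchange⊆fill-off-block {i} {k} {w} (inj₂ (_ , _ , _ , _ , refl)) t≢i (_ , τ⊆F , _) =
    τ⊆F ∘ exchange⊆τ {τ = τ} {i , k} {w} t≢i

  exchange-fill-step : ∀ {i k w} {F F' : Subset (n i)} → WChoice n a τ (i , k) w →
    IsFill n a τ i F → IsFill n a (exchange τ (i , k) w) i F' → RevLe F F' × leadRun F ≤ leadRun F'
  exchange-fill-step {i} {k} (inj₁ (_ , gap)) fill@(∣F∣≡a , _ , _) fill' =
    fill-dominates ∣F∣≡a (exchange-gap⊆fill {v = i , k} gap fill) fill'
  exchange-fill-step {F' = F'} (inj₂ (_ , (k∈τ , f' , (_ , f'∉τ , _) , f'<k) , f , (full , f∉τ , f-first) , refl))
    fill fill' =
    fill-replace-by-earlier k∈τ f∉τ (≤-<-trans (f-first f' f'∉τ) f'<k) full fill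
      (subst (λ S → IsFillOf _ S F') (exchange-within-block {τ = τ}) fill')

lemma6p8 : (m : ℕ) (n a : Fin m → ℕ) → (∀ i → a i ≤ n i) →
    (d : ℕ) → 1 ≤ d → d ≤ total a →
    (τ : VSet n) → Facet n a d τ →
    (γ : VSet n) → ProperSubV n γ τ →
    (i : Fin m) (k : Fin (n i)) (j : Fin m) (l : Fin (n j)) →
    InRLex n a d τ (i , k) → (i , k) ∉V γ →
    WChoice n a τ (i , k) (j , l) →
    ((t : Fin m) → ¬ (t ≡ i) → (F F' : Subset (n t)) →
       IsFill n a τ t F → IsFill n a (exchange τ (i , k) (j , l)) t F' →
       (F ≡ F') × (phi F ≡ phi F'))
    ×
    ((F F' : Subset (n i)) →
       IsFill n a τ i F → IsFill n a (exchange τ (i , k) (j , l)) i F' →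
       RevLe F F' × (length (phi F') ≤ length (phi F)))
lemma6p8 m n a _ d _ _ τ (τ-small , _) γ _ i k j l _ _ w-choice =
  (λ t t≢i F F' fill fill' →
     let F≡F' = fill-unique fill fill' (τ⊆exchange {τ = τ} {i , k} {j , l} t≢i)
                                       (exchange⊆fill-off-block τ-small w-choice t≢i fill)
     in F≡F' , cong phi F≡F')
  , λ F F' fill fill' →
      let F⪯F' , run≤run' = exchange-fill-step τ-small w-choice fill fill'
      in F⪯F' , length-phi-antitone (trans (proj₁ fill) (sym (proj₁ fill'))) run≤run'
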